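{- Let $d\ge0$ be an integer. Then: (i) $A(d+1,j,1)\le A(d+1,j,2)\le\dots\le A(d+1,j,d+1)$ for $\lfloor\frac{d+2}{2}\rfloor\le j\le d$; (ii) $A(d+1,j,1)\ge A(d+1,j,2)\ge\dots\ge A(d+1,j,d+1)$ for $0\le j\le\lfloor\frac{d-1}{2}\rfloor$; (iii) if $d$ is even, $A(d+1,\frac d2,1)\le A(d+1,\frac d2,2)\le\dots\le A(d+1,\frac d2,\frac d2+1)\ge A(d+1,\frac d2,\frac d2+2)\ge\dots\ge A(d+1,\frac d2,d+1)$; (iv) $A(d+1,j,1)=A(d+1,j+1,d+1)$ for $0\le j\le d-1$.
   Context: For $n\ge1$, $S_n$ is the symmetric group on $[n]=\{1,\dots,n\}$. For $\sigma\in S_n$, $\mathrm{des}(\sigma)=\#\{i\in[n-1]:\sigma(i)>\sigma(i+1)\}$. For $0\le i\le n-1$ and $1\le j\le n$, $A(n,i,j)=\#\{\sigma\in S_n:\mathrm{des}(\sigma)=i,\ \sigma(1)=j\}$. -}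

module Defs where

open import Data.Nat using (ℕ; zero; suc; _+_; _≡ᵇ_; _<ᵇ_)
open import Data.Bool using (Bool; true; false; _∧_; not; if_then_else_)
open import Data.Fin using (Fin; toℕ)
open import Data.Fin.Properties using (_≟_)
open import Data.List using (List; []; _∷_; concatMap; map; allFin; length; filterᵇ)
open import Data.Vec using (Vec; []; _∷_)
open import Relation.Nullary.Decidable using (⌊_⌋)

allVecs : (k n : ℕ) → List (Vec (Fin n) k)
allVecs zero    n = [] ∷ []
allVecs (suc k) n = concatMap (λ x → map (x ∷_) (allVecs k n)) (allFin n)

notIn : ∀ {n k} → Fin n → Vec (Fin n) k → Bool
notIn x []       = true
notIn x (y ∷ ys) = not ⌊ x ≟ y ⌋ ∧ notIn x ys

distinct : ∀ {n k} → Vec (Fin n) k → Bool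
distinct []       = true
distinct (x ∷ xs) = notIn x xs ∧ distinct xs

-- The permutations of [n], in one-line notation (σ(1),…,σ(n)), with the
-- value v ∈ Fin n standing for the integer toℕ v + 1 ∈ [n].
perms : (n : ℕ) → List (Vec (Fin n) n)
perms n = filterᵇ distinct (allVecs n n)

des : ∀ {n k} → Vec (Fin n) k → ℕ
des []               = 0
des (x ∷ [])         = 0
des (x ∷ y ∷ ys) = (if toℕ y <ᵇ toℕ x then 1 else 0) + des (y ∷ ys)

first : ∀ {n k} → Vec (Fin n) k → ℕ
first []      = 0
first (x ∷ _) = suc (toℕ x)

A : ℕ → ℕ → ℕ → ℕ
A n i j = length (filterᵇ (λ σ → (des σ ≡ᵇ i) ∧ (first σ ≡ᵇ j)) (perms n))

-- Write E n b i for A(n + 1, i, b + 1). Conditioning on the second letter gives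
-- E (n + 1) b i = Σ_{z < b} E n z (i − 1) + Σ_{b ≤ z ≤ n} E n z i, hence
-- A(d + 1, i, b + 2) − A(d + 1, i, b + 1) = E (d − 1) b (i − 1) − E (d − 1) b i, and monotonicity
-- in the first letter becomes monotonicity of E in the number of descents. Complementing values
-- gives E n b i = E n (n − b) (n − i), which turns the increasing half (2i ≤ n, and 2i = n + 1
-- when b ≥ i) into the decreasing half; the increasing half is proved by induction on n from the
-- recurrence, using the same symmetry to pair terms of the sums near the middle. Part (iv): a
-- permutation with first letter d + 1 has one more descent than its counterpart with first letter 1.

module Submission where

open import Defs
open import Data.Nat using (ℕ; zero; suc; _+_; _*_; _∸_; _/_; _%_; _≤_; _<_; _≥_; _≤?_; z≤n; s≤s; z<s; s<s; _<ᵇ_; _≡ᵇ_)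
open import Data.Nat.Properties renaming (_≟_ to _≟ℕ_)
open import Data.Nat.DivMod using (m≡m%n+[m/n]*n; m%n<n)
open import Data.Nat.Tactic.RingSolver using (solve-∀)
open import Algebra.Properties.CommutativeSemigroup +-commutativeSemigroup using (xy∙z≈zx∙y; xy∙z≈xz∙y)
open import Algebra.Properties.CommutativeMonoid.Sum +-0-commutativeMonoid
  using (sum-syntax; sum-cong-≗; sum-remove; sum-replicate-zero)
open import Data.Bool using (Bool; true; false; _∧_; not; if_then_else_)
open import Data.Bool.Properties using (∧-assoc; ∧-zeroʳ; ∧-identityʳ)
open import Data.Fin using (Fin; toℕ; fromℕ<; punchIn) renaming (zero to fzero; suc to fsuc)
open import Data.Fin.Properties using (_≟_; punchIn-injective; punchInᵢ≢i; toℕ-injective; toℕ-fromℕ<)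
open import Data.List using (List; []; _∷_; _++_; concatMap; map; length; filterᵇ; tabulate)
open import Data.Vec using (Vec; []; _∷_) renaming (map to vmap)
open import Data.Product using (_×_; _,_)
open import Data.Empty using (⊥-elim)
open import Function using (_∘_)
open import Relation.Binary.PropositionalEquality
open import Relation.Nullary using (¬_; yes; no)
open import Relation.Nullary.Reflects using (ofʸ; ofⁿ)
open import Relation.Nullary.Decidable using (Dec; ⌊_⌋; dec-true; dec-false; isYes≗does)

sumBelow : ℕ → (ℕ → ℕ) → ℕ
sumBelow zero    f = 0
sumBelow (suc n) f = f 0 + sumBelow n (f ∘ suc)

sumFrom : ℕ → ℕ → (ℕ → ℕ) → ℕ
sumFrom b c f = sumBelow c (λ t → f (b + t))

sumBelow-cong : ∀ n {f g : ℕ → ℕ} → (∀ t → t < n → f t ≡ g t) → sumBelow n f ≡ sumBelow n g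
sumBelow-cong zero    _   = refl
sumBelow-cong (suc n) f≡g = cong₂ _+_ (f≡g 0 z<s) (sumBelow-cong n (λ t t<n → f≡g (suc t) (s<s t<n)))

sumBelow-mono : ∀ n {f g : ℕ → ℕ} → (∀ t → t < n → f t ≤ g t) → sumBelow n f ≤ sumBelow n g
sumBelow-mono zero    _   = z≤n
sumBelow-mono (suc n) f≤g = +-mono-≤ (f≤g 0 z<s) (sumBelow-mono n (λ t t<n → f≤g (suc t) (s<s t<n)))

sumBelow-zero : ∀ n {f : ℕ → ℕ} → (∀ t → t < n → f t ≡ 0) → sumBelow n f ≡ 0
sumBelow-zero zero    _    = refl
sumBelow-zero (suc n) f≡0 = cong₂ _+_ (f≡0 0 z<s) (sumBelow-zero n (λ t t<n → f≡0 (suc t) (s<s t<n)))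

sumBelow-+ : ∀ m n f → sumBelow (m + n) f ≡ sumBelow m f + sumFrom m n f
sumBelow-+ zero    n f = refl
sumBelow-+ (suc m) n f = trans (cong (f 0 +_) (sumBelow-+ m n (f ∘ suc))) (sym (+-assoc (f 0) _ _))

sumBelow-suc : ∀ n f → sumBelow (suc n) f ≡ sumBelow n f + f n
sumBelow-suc zero    f = +-identityʳ (f 0)
sumBelow-suc (suc n) f = trans (cong (f 0 +_) (sumBelow-suc n (f ∘ suc))) (sym (+-assoc (f 0) _ _))

sumBelow-reverse : ∀ n f → sumBelow n f ≡ sumBelow n (λ t → f (n ∸ suc t))
sumBelow-reverse zero    f = refl
sumBelow-reverse (suc n) f = begin
  sumBelow (suc n) f                      ≡⟨ sumBelow-suc n f ⟩
  sumBelow n f + f n                      ≡⟨ +-comm (sumBelow n f) (f n) ⟩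
  f n + sumBelow n f                      ≡⟨ cong (f n +_) (sumBelow-reverse n f) ⟩
  f n + sumBelow n (λ t → f (n ∸ suc t))  ∎
  where open ≡-Reasoning

2*m≡m+m : ∀ m → 2 * m ≡ m + m
2*m≡m+m m = cong (m +_) (+-identityʳ m)

window-bound : ∀ {n b c t} → b + c ≡ suc n → t < c → b + t ≤ n
window-bound {b = b} {t = t} bc t<c = ≤-pred (subst (b + t <_) bc (+-monoʳ-< b t<c))

sumFrom-+ : ∀ b p q f → sumFrom b (p + q) f ≡ sumFrom b p f + sumFrom (b + p) q f
sumFrom-+ b p q f = trans (sumBelow-+ p q _)
  (cong (sumFrom b p f +_) (sumBelow-cong q (λ t _ → cong f (sym (+-assoc b p t)))))

sumFrom-suc : ∀ b c f → sumFrom b (suc c) f ≡ f b + sumFrom (suc b) c f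
sumFrom-suc b c f = cong₂ _+_ (cong f (+-identityʳ b)) (sumBelow-cong c (λ t _ → cong f (+-suc b t)))

-- The term at b + t on the left is paired with the one at a + (c − 1 − t) on the right.
sumFrom-reflect : ∀ {N} b a c {f g : ℕ → ℕ} → b + c + a ≡ suc N →
                  (∀ z z' → z + z' ≡ N → f z ≡ g z') → sumFrom b c f ≡ sumFrom a c g
sumFrom-reflect {N} b a c {f} {g} eq f≡g = begin
  sumFrom b c f                           ≡⟨ sumBelow-reverse c _ ⟩
  sumBelow c (λ t → f (b + (c ∸ suc t)))  ≡⟨ sumBelow-cong c (λ t t<c → f≡g _ _ (mirror t t<c)) ⟩
  sumFrom a c g                           ∎
  where
  open ≡-Reasoning
  mirror : ∀ t → t < c → b + (c ∸ suc t) + (a + t) ≡ N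
  mirror t t<c = suc-injective (begin
    suc (b + (c ∸ suc t) + (a + t))  ≡⟨ shuffle b (c ∸ suc t) a t ⟩
    b + (c ∸ suc t + suc t) + a      ≡⟨ cong (λ x → b + x + a) (m∸n+n≡m t<c) ⟩
    b + c + a                        ≡⟨ eq ⟩
    suc N                            ∎)
    where
    shuffle : ∀ b r a t → suc (b + r + (a + t)) ≡ b + (r + suc t) + a
    shuffle = solve-∀

-- On the window [b, N], the half below N/2 is matched by the reflection z ↦ N − z
-- with a part of the half above it, so v ≤ u on the upper half suffices.
sumFrom-≤-mirrored : ∀ {N} b c {u v : ℕ → ℕ} → b + c ≡ suc N →
                     (∀ z z' → z + z' ≡ N → v z ≡ u z') →
                     (∀ z → z ≤ N → N < 2 * z → v z ≤ u z) →
                     sumFrom b c v ≤ sumFrom b c u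
sumFrom-≤-mirrored {N} b c {u} {v} bc v≡u v≤u with c ≤? b
... | yes c≤b = sumBelow-mono c λ t t<c → v≤u (b + t) (window-bound bc t<c) (begin
  suc N              ≡⟨ bc ⟨
  b + c              ≤⟨ +-monoʳ-≤ b c≤b ⟩
  b + b              ≤⟨ +-mono-≤ (m≤m+n b t) (m≤m+n b t) ⟩
  (b + t) + (b + t)  ≡⟨ 2*m≡m+m (b + t) ⟨
  2 * (b + t)        ∎)
  where open ≤-Reasoning
... | no c≰b = centred (c ∸ b) (m∸n+n≡m (<⇒≤ (≰⇒> c≰b)))
  where
  open ≤-Reasoning
  centred : ∀ r → r + b ≡ c → sumFrom b c v ≤ sumFrom b c u
  centred r r+b≡c = begin
    sumFrom b c v                        ≡⟨ cong (λ c → sumFrom b c v) r+b≡c ⟨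
    sumFrom b (r + b) v                  ≡⟨ sumFrom-+ b r b v ⟩
    sumFrom b r v + sumFrom (b + r) b v  ≤⟨ +-mono-≤ (≤-reflexive centre) (sumBelow-mono b upper) ⟩
    sumFrom b r u + sumFrom (b + r) b u  ≡⟨ sumFrom-+ b r b u ⟨
    sumFrom b (r + b) u                  ≡⟨ cong (λ c → sumFrom b c u) r+b≡c ⟩
    sumFrom b c u                        ∎
    where
    size : b + r + b ≡ suc N
    size = trans (+-assoc b r b) (trans (cong (b +_) r+b≡c) bc)
    centre : sumFrom b r v ≡ sumFrom b r u
    centre = sumFrom-reflect b b r size v≡u
    upper : ∀ t → t < b → v (b + r + t) ≤ u (b + r + t)
    upper t t<b = v≤u (b + r + t) (window-bound size t<b) (begin
      suc N                      ≡⟨ size ⟨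
      b + r + b                  ≤⟨ +-monoʳ-≤ (b + r) (≤-trans (m≤m+n b r) (m≤m+n (b + r) t)) ⟩
      b + r + (b + r + t)        ≤⟨ +-monoˡ-≤ (b + r + t) (m≤m+n (b + r) t) ⟩
      b + r + t + (b + r + t)    ≡⟨ 2*m≡m+m (b + r + t) ⟨
      2 * (b + r + t)            ∎)

sumBelow-exchange : ∀ {b c} {f g : ℕ → ℕ} → c ≤ b → (∀ z → z < b → g z ≤ f z) →
                    sumBelow b g + sumBelow c f ≤ sumBelow b f + sumBelow c g
sumBelow-exchange {b} {c} {f} {g} c≤b g≤f = exchange (b ∸ c) (m+[n∸m]≡n c≤b)
  where
  open ≤-Reasoning
  exchange : ∀ r → c + r ≡ b → sumBelow b g + sumBelow c f ≤ sumBelow b f + sumBelow c g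
  exchange r refl = begin
    sumBelow (c + r) g + F                 ≡⟨ cong (_+ F) (sumBelow-+ c r g) ⟩
    G + sumFrom c r g + F                  ≡⟨ xy∙z≈zx∙y G (sumFrom c r g) F ⟩
    F + G + sumFrom c r g                  ≤⟨ +-monoʳ-≤ (F + G) (sumBelow-mono r λ t t<r → g≤f (c + t) (+-monoʳ-< c t<r)) ⟩
    F + G + sumFrom c r f                  ≡⟨ xy∙z≈xz∙y F G (sumFrom c r f) ⟩
    F + sumFrom c r f + G                  ≡⟨ cong (_+ G) (sumBelow-+ c r f) ⟨
    sumBelow (c + r) f + G                 ∎
    where
    F = sumBelow c f
    G = sumBelow c g

-- Refined Eulerian numbers

-- E n b i = A(n + 1, i, b + 1) for b ≤ n: conditioning on the second letter, which is the
-- (z + 1)-st smallest of the remaining n + 1 letters, creates a descent exactly when z < b.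
mutual
  E : ℕ → ℕ → ℕ → ℕ
  E zero    _ zero    = 1
  E zero    _ (suc _) = 0
  E (suc n) b i       = sumBelow (suc n) λ z → if z <ᵇ b then E⁻ n z i else E n z i

  E⁻ : ℕ → ℕ → ℕ → ℕ
  E⁻ n b zero    = 0
  E⁻ n b (suc i) = E n b i

if-<ᵇ : ∀ {A : Set} {z b} {x y : A} → z < b → (if z <ᵇ b then x else y) ≡ x
if-<ᵇ {z = z} {b} z<b with z <ᵇ b | <ᵇ-reflects-< z b
... | true  | _        = refl
... | false | ofⁿ z≮b = ⊥-elim (z≮b z<b)

if-≮ᵇ : ∀ {A : Set} {z b} {x y : A} → b ≤ z → (if z <ᵇ b then x else y) ≡ y
if-≮ᵇ {z = z} {b} b≤z with z <ᵇ b | <ᵇ-reflects-< z b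
... | true  | ofʸ z<b = ⊥-elim (<⇒≱ z<b b≤z)
... | false | _       = refl

E-split : ∀ {n} b c i → b + c ≡ suc n →
          E (suc n) b i ≡ sumBelow b (λ z → E⁻ n z i) + sumFrom b c (λ z → E n z i)
E-split {n} b c i bc = begin
  sumBelow (suc n) summand                  ≡⟨ cong (λ l → sumBelow l summand) bc ⟨
  sumBelow (b + c) summand                  ≡⟨ sumBelow-+ b c summand ⟩
  sumBelow b summand + sumFrom b c summand  ≡⟨ cong₂ _+_ (sumBelow-cong b λ _ z<b → if-<ᵇ z<b)
                                                         (sumBelow-cong c λ t _ → if-≮ᵇ (m≤m+n b t)) ⟩
  sumBelow b (λ z → E⁻ n z i) + sumFrom b c (λ z → E n z i)  ∎
  where
  open ≡-Reasoning
  summand = λ z → if z <ᵇ b then E⁻ n z i else E n z i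

E-vanish : ∀ n b {i} → n < i → E n b i ≡ 0
E-vanish zero    b {suc i} _         = refl
E-vanish (suc n) b {suc i} (s<s n<i) = sumBelow-zero (suc n) λ z _ → vanish z
  where
  vanish : ∀ z → (if z <ᵇ b then E⁻ n z (suc i) else E n z (suc i)) ≡ 0
  vanish z with z <ᵇ b
  ... | true  = E-vanish n z n<i
  ... | false = E-vanish n z (m<n⇒m<1+n n<i)

-- Complementing values (k ↦ n + 2 − k) exchanges ascents and descents.
mutual
  E-complement : ∀ {n b b' i i'} → b + b' ≡ n → i + i' ≡ n → E n b i ≡ E n b' i'
  E-complement {zero} {i = zero} {zero}  _ _  = refl
  E-complement {zero} {i = zero} {suc _} _ ()
  E-complement {zero} {i = suc _}        _ ()
  E-complement {suc n} {b} {b'} {i} {i'} bb' ii' = begin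
    E (suc n) b i                                                     ≡⟨ E-split b b' i bb' ⟩
    sumBelow b (λ z → E⁻ n z i) + sumFrom b b' (λ z → E n z i)        ≡⟨ cong₂ _+_ lower upper ⟩
    sumFrom b' b (λ z → E n z i') + sumBelow b' (λ z → E⁻ n z i')     ≡⟨ +-comm (sumFrom b' b (λ z → E n z i')) _ ⟩
    sumBelow b' (λ z → E⁻ n z i') + sumFrom b' b (λ z → E n z i')     ≡⟨ E-split b' b i' (trans (+-comm b' b) bb') ⟨
    E (suc n) b' i'                                                   ∎
    where
    open ≡-Reasoning
    lower : sumBelow b (λ z → E⁻ n z i) ≡ sumFrom b' b (λ z → E n z i')
    lower = sumFrom-reflect 0 b' b {g = λ z → E n z i'} bb' λ _ _ zz' → E⁻-complement zz' ii'
    upper : sumFrom b b' (λ z → E n z i) ≡ sumBelow b' (λ z → E⁻ n z i')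
    upper = sumFrom-reflect b 0 b' {f = λ z → E n z i} (trans (+-identityʳ _) bb') λ z z' zz' →
              sym (E⁻-complement {n} {z'} {z} {i'} {i} (trans (+-comm z' z) zz') (trans (+-comm i' i) ii'))

  E⁻-complement : ∀ {n b b' i i'} → b + b' ≡ n → i + i' ≡ suc n → E⁻ n b i ≡ E n b' i'
  E⁻-complement {n} {i = zero}  _   ii' = sym (E-vanish n _ (≤-reflexive (sym ii')))
  E⁻-complement     {i = suc _} bb' ii' = E-complement bb' (suc-injective ii')

-- Raising the first letter by one only changes the summand for the second letter z = b,
-- which turns from an ascent into a descent.
E-step : ∀ {n} b c i → b + c ≡ n → E (suc n) (suc b) i + E n b i ≡ E (suc n) b i + E⁻ n b i
E-step {n} b c i bc = begin
  E (suc n) (suc b) i + E n b i                    ≡⟨ cong (_+ E n b i) (E-split (suc b) c i (cong suc bc)) ⟩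
  sumBelow (suc b) E⁻ᵢ + Y + E n b i               ≡⟨ cong (λ x → x + Y + E n b i) (sumBelow-suc b E⁻ᵢ) ⟩
  S + E⁻ n b i + Y + E n b i                       ≡⟨ shuffle S (E⁻ n b i) Y (E n b i) ⟩
  S + (E n b i + Y) + E⁻ n b i                     ≡⟨ cong (λ x → S + x + E⁻ n b i) (sumFrom-suc b c Eᵢ) ⟨
  S + sumFrom b (suc c) Eᵢ + E⁻ n b i              ≡⟨ cong (_+ E⁻ n b i) (E-split b (suc c) i (trans (+-suc b c) (cong suc bc))) ⟨
  E (suc n) b i + E⁻ n b i                         ∎
  where
  open ≡-Reasoning
  E⁻ᵢ = λ z → E⁻ n z i
  Eᵢ  = λ z → E n z i
  S = sumBelow b E⁻ᵢ
  Y = sumFrom (suc b) c Eᵢ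
  shuffle : ∀ s p y e → s + p + y + e ≡ s + (e + y) + p
  shuffle = solve-∀

E-first-last : ∀ n i → E (suc n) 0 i ≡ E (suc n) (suc n) (suc i)
E-first-last n i = sym (sumBelow-cong (suc n) {g = λ z → E n z i} λ z z<n+1 → if-<ᵇ {y = E n z (suc i)} z<n+1)

-- The sums over z < b compare termwise, and so do the sums
-- over z ≥ b unless 2 (i + 1) = n + 1; then they are compared by pairing z with n − z. In the
-- middle case both tails are reflected into sums over z < n + 1 − b ≤ b and exchanged.
mutual
  E-ascending : ∀ {n i b} → 2 * i ≤ n → b ≤ n → E⁻ n b i ≤ E n b i
  E-ascending {i = zero} _ _ = z≤n
  E-ascending {suc n} {suc i} {b} 2i+2≤n+1 b≤n+1 = begin
    E (suc n) b i                                                    ≡⟨ E-split b c i bc ⟩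
    sumBelow b (λ z → E⁻ n z i) + sumFrom b c (λ z → E n z i)        ≤⟨ +-mono-≤ lower upper ⟩
    sumBelow b (λ z → E n z i) + sumFrom b c (λ z → E n z (suc i))   ≡⟨ E-split b c (suc i) bc ⟨
    E (suc n) b (suc i)                                              ∎
    where
    open ≤-Reasoning
    c = suc n ∸ b
    bc : b + c ≡ suc n
    bc = m+[n∸m]≡n b≤n+1
    lower : sumBelow b (λ z → E⁻ n z i) ≤ sumBelow b (λ z → E n z i)
    lower = sumBelow-mono b λ z z<b →
      E-ascending (≤-pred (<-≤-trans (*-monoʳ-< 2 (n<1+n i)) 2i+2≤n+1)) (≤-pred (≤-trans z<b b≤n+1))
    upper : sumFrom b c (λ z → E n z i) ≤ sumFrom b c (λ z → E n z (suc i))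
    upper with 2 * suc i ≤? n
    ... | yes 2i+2≤n = sumBelow-mono c λ t t<c → E-ascending 2i+2≤n (window-bound bc t<c)
    ... | no  2i+2≰n = sumFrom-≤-mirrored b c bc (λ _ _ zz' → E-complement zz' i+i+1≡n) λ z z≤n n<2z →
          E-ascending-middle 2i+2≡n+1 (*-cancelˡ-≤ 2 (subst (_≤ 2 * z) (sym 2i+2≡n+1) n<2z)) z≤n
      where
      2i+2≡n+1 : 2 * suc i ≡ suc n
      2i+2≡n+1 = ≤-antisym 2i+2≤n+1 (≰⇒> 2i+2≰n)
      i+i+1≡n : i + suc i ≡ n
      i+i+1≡n = suc-injective (trans (sym (2*m≡m+m (suc i))) 2i+2≡n+1)

  E-ascending-middle : ∀ {n i b} → 2 * i ≡ suc n → i ≤ b → b ≤ n → E⁻ n b i ≤ E n b i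
  E-ascending-middle {i = zero} _ _ _ = z≤n
  E-ascending-middle {zero} {suc i} {zero}  _ () _
  E-ascending-middle {zero} {suc i} {suc b} _ _ ()
  E-ascending-middle {suc n} {suc i} {b} 2i+2≡n+2 i<b b≤n+1 = begin
    E (suc n) b i                                                    ≡⟨ E-split b c i bc ⟩
    sumBelow b (λ z → E⁻ n z i) + sumFrom b c (λ z → E n z i)        ≡⟨ cong (sumBelow b _ +_) left-tail ⟩
    sumBelow b (λ z → E⁻ n z i) + sumBelow c (λ z → E n z i)         ≤⟨ sumBelow-exchange c≤b below-middle ⟩
    sumBelow b (λ z → E n z i) + sumBelow c (λ z → E⁻ n z i)         ≡⟨ cong (sumBelow b _ +_) right-tail ⟨
    sumBelow b (λ z → E n z i) + sumFrom b c (λ z → E n z (suc i))   ≡⟨ E-split b c (suc i) bc ⟨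
    E (suc n) b (suc i)                                              ∎
    where
    open ≤-Reasoning
    c = suc n ∸ b
    bc : b + c ≡ suc n
    bc = m+[n∸m]≡n b≤n+1
    i+i≡n : i + i ≡ n
    i+i≡n = suc-injective (trans (sym (+-suc i i)) (suc-injective (trans (sym (2*m≡m+m (suc i))) 2i+2≡n+2)))
    2i≤n : 2 * i ≤ n
    2i≤n = ≤-reflexive (trans (2*m≡m+m i) i+i≡n)
    c≤b : c ≤ b
    c≤b = ≤-trans (+-cancelʳ-≤ (suc i) c i (begin
      c + suc i  ≤⟨ +-monoʳ-≤ c i<b ⟩
      c + b      ≡⟨ +-comm c b ⟩
      b + c      ≡⟨ bc ⟩
      suc n      ≡⟨ cong suc i+i≡n ⟨
      suc i + i  ≡⟨ +-comm (suc i) i ⟩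
      i + suc i  ∎)) (≤-trans (n≤1+n i) i<b)
    below-middle : ∀ z → z < b → E⁻ n z i ≤ E n z i
    below-middle z z<b = E-ascending 2i≤n (≤-pred (≤-trans z<b b≤n+1))
    left-tail : sumFrom b c (λ z → E n z i) ≡ sumBelow c (λ z → E n z i)
    left-tail = sumFrom-reflect b 0 c (trans (+-identityʳ _) bc) λ _ _ zz' → E-complement zz' i+i≡n
    right-tail : sumFrom b c (λ z → E n z (suc i)) ≡ sumBelow c (λ z → E⁻ n z i)
    right-tail = sumFrom-reflect b 0 c (trans (+-identityʳ _) bc) λ z z' zz' →
      sym (E⁻-complement {n} {z'} {z} {i} {suc i} (trans (+-comm z' z) zz') (trans (+-suc i i) (cong suc i+i≡n)))

E-descent-from-complement : ∀ {n b b' i j} → b + b' ≡ n → i + j ≡ suc n →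
                            E⁻ n b' j ≤ E n b' j → E n b i ≤ E⁻ n b i
E-descent-from-complement {b = b} {b'} {i} {j} bb' ij =
  subst₂ _≤_ (E⁻-complement (trans (+-comm b' b) bb') (trans (+-comm j i) ij)) (sym (E⁻-complement bb' ij))

E-descending : ∀ {n i b} → suc n < 2 * i → b ≤ n → E n b i ≤ E⁻ n b i
E-descending {n} {i} {b} n+1<2i b≤n with i ≤? suc n
... | no  i≰n+1 = ≤-trans (≤-reflexive (E-vanish n b (<-trans (n<1+n n) (≰⇒> i≰n+1)))) z≤n
... | yes i≤n+1 = E-descent-from-complement (m+[n∸m]≡n b≤n) ij (E-ascending 2j≤n (m∸n≤m n b))
  where
  open ≤-Reasoning
  j = suc n ∸ i
  ij : i + j ≡ suc n
  ij = m+[n∸m]≡n i≤n+1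
  2j≤n : 2 * j ≤ n
  2j≤n = +-cancelˡ-≤ (2 + n) (2 * j) n (begin
    2 + n + 2 * j  ≤⟨ +-monoˡ-≤ (2 * j) n+1<2i ⟩
    2 * i + 2 * j  ≡⟨ *-distribˡ-+ 2 i j ⟨
    2 * (i + j)    ≡⟨ cong (2 *_) ij ⟩
    2 * suc n      ≡⟨ *-suc 2 n ⟩
    2 + 2 * n      ≡⟨ cong (2 +_) (2*m≡m+m n) ⟩
    2 + n + n      ∎)

E-descending-middle : ∀ {n i b} → 2 * i ≡ suc n → b < i → E n b i ≤ E⁻ n b i
E-descending-middle {n} {i} {b} 2i≡n+1 b<i =
  E-descent-from-complement bb' i+i≡n+1 (E-ascending-middle 2i≡n+1 i≤b' (m∸n≤m n b))
  where
  open ≤-Reasoning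
  i+i≡n+1 : i + i ≡ suc n
  i+i≡n+1 = trans (sym (2*m≡m+m i)) 2i≡n+1
  b' = n ∸ b
  bb' : b + b' ≡ n
  bb' = m+[n∸m]≡n (≤-pred (≤-trans b<i (subst (i ≤_) i+i≡n+1 (m≤m+n i i))))
  i≤b' : i ≤ b'
  i≤b' = +-cancelʳ-≤ (suc b) i b' (begin
    i + suc b    ≤⟨ +-monoʳ-≤ i b<i ⟩
    i + i        ≡⟨ i+i≡n+1 ⟩
    suc n        ≡⟨ cong suc bb' ⟨
    suc (b + b') ≡⟨ cong suc (+-comm b b') ⟩
    suc (b' + b) ≡⟨ +-suc b' b ⟨
    b' + suc b   ∎)

-- Counting permutations by their first letter

private
  variable
    X Y : Set

length-filterᵇ-++ : ∀ (P : X → Bool) xs ys →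
                    length (filterᵇ P (xs ++ ys)) ≡ length (filterᵇ P xs) + length (filterᵇ P ys)
length-filterᵇ-++ P []       ys = refl
length-filterᵇ-++ P (x ∷ xs) ys with P x
... | true  = cong suc (length-filterᵇ-++ P xs ys)
... | false = length-filterᵇ-++ P xs ys

length-filterᵇ-map : ∀ (P : Y → Bool) (f : X → Y) xs → length (filterᵇ P (map f xs)) ≡ length (filterᵇ (P ∘ f) xs)
length-filterᵇ-map P f []       = refl
length-filterᵇ-map P f (x ∷ xs) with P (f x)
... | true  = cong suc (length-filterᵇ-map P f xs)
... | false = length-filterᵇ-map P f xs

length-filterᵇ-cong : ∀ {P Q : X → Bool} xs → (∀ x → P x ≡ Q x) → length (filterᵇ P xs) ≡ length (filterᵇ Q xs)
length-filterᵇ-cong {P = P} {Q} []       _   = refl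
length-filterᵇ-cong {P = P} {Q} (x ∷ xs) P≡Q with P x | Q x | P≡Q x
... | true  | true  | _ = cong suc (length-filterᵇ-cong xs P≡Q)
... | false | false | _ = length-filterᵇ-cong xs P≡Q

length-filterᵇ-none : ∀ {P : X → Bool} xs → (∀ x → P x ≡ false) → length (filterᵇ P xs) ≡ 0
length-filterᵇ-none {P = P} []       _ = refl
length-filterᵇ-none {P = P} (x ∷ xs) P≡false with P x | P≡false x
... | false | _ = length-filterᵇ-none xs P≡false

length-filterᵇ-filterᵇ : ∀ (P Q : X → Bool) xs →
                         length (filterᵇ P (filterᵇ Q xs)) ≡ length (filterᵇ (λ x → Q x ∧ P x) xs)
length-filterᵇ-filterᵇ P Q []       = refl
length-filterᵇ-filterᵇ P Q (x ∷ xs) with Q x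
... | false = length-filterᵇ-filterᵇ P Q xs
... | true with P x
...   | true  = cong suc (length-filterᵇ-filterᵇ P Q xs)
...   | false = length-filterᵇ-filterᵇ P Q xs

length-filterᵇ-concatMap-tabulate : ∀ {n} (P : Y → Bool) (h : X → List Y) (g : Fin n → X) →
  length (filterᵇ P (concatMap h (tabulate g))) ≡ ∑[ x < n ] length (filterᵇ P (h (g x)))
length-filterᵇ-concatMap-tabulate {n = zero}  P h g = refl
length-filterᵇ-concatMap-tabulate {n = suc n} P h g =
  trans (length-filterᵇ-++ P (h (g fzero)) _) (cong (_ +_) (length-filterᵇ-concatMap-tabulate P h (g ∘ fsuc)))

count : ∀ k n → (Vec (Fin n) k → Bool) → ℕ
count k n P = length (filterᵇ P (allVecs k n))

count-cong : ∀ k n {P Q : Vec (Fin n) k → Bool} → (∀ v → P v ≡ Q v) → count k n P ≡ count k n Q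
count-cong k n = length-filterᵇ-cong (allVecs k n)

count-none : ∀ k n {P : Vec (Fin n) k → Bool} → (∀ v → P v ≡ false) → count k n P ≡ 0
count-none k n = length-filterᵇ-none (allVecs k n)

count-∷ : ∀ k n (P : Vec (Fin n) (suc k) → Bool) → count (suc k) n P ≡ ∑[ x < n ] count k n (λ v → P (x ∷ v))
count-∷ k n P = trans (length-filterᵇ-concatMap-tabulate P (λ x → map (x ∷_) (allVecs k n)) (λ x → x))
                      (sum-cong-≗ λ x → length-filterᵇ-map P (x ∷_) (allVecs k n))

⌊⌋-true : ∀ {P : Set} (p? : Dec P) → P → ⌊ p? ⌋ ≡ true
⌊⌋-true p? p = trans (isYes≗does p?) (dec-true p? p)

⌊⌋-false : ∀ {P : Set} (p? : Dec P) → ¬ P → ⌊ p? ⌋ ≡ false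
⌊⌋-false p? ¬p = trans (isYes≗does p?) (dec-false p? ¬p)

punchIn-≟ : ∀ {n} (x : Fin (suc n)) (a b : Fin n) → ⌊ punchIn x a ≟ punchIn x b ⌋ ≡ ⌊ a ≟ b ⌋
punchIn-≟ x a b with a ≟ b
... | yes refl = ⌊⌋-true (punchIn x a ≟ punchIn x a) refl
... | no  a≢b  = ⌊⌋-false (punchIn x a ≟ punchIn x b) (a≢b ∘ punchIn-injective x a b)

notIn-punchIn : ∀ {n k} (x : Fin (suc n)) a (w : Vec (Fin n) k) → notIn (punchIn x a) (vmap (punchIn x) w) ≡ notIn a w
notIn-punchIn x a []      = refl
notIn-punchIn x a (b ∷ w) = cong₂ (λ s t → not s ∧ t) (punchIn-≟ x a b) (notIn-punchIn x a w)

distinct-punchIn : ∀ {n k} (x : Fin (suc n)) (w : Vec (Fin n) k) → distinct (vmap (punchIn x) w) ≡ distinct w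
distinct-punchIn x []      = refl
distinct-punchIn x (a ∷ w) = cong₂ _∧_ (notIn-punchIn x a w) (distinct-punchIn x w)

count-avoiding : ∀ k {n} (x : Fin (suc n)) (Q : Vec (Fin (suc n)) k → Bool) →
                 count k (suc n) (λ v → notIn x v ∧ Q v) ≡ count k n (λ w → Q (vmap (punchIn x) w))
count-avoiding zero    x Q with Q []
... | true  = refl
... | false = refl
count-avoiding (suc k) {n} x Q = begin
  count (suc k) (suc n) (λ v → notIn x v ∧ Q v)    ≡⟨ count-∷ k (suc n) _ ⟩
  ∑[ y < suc n ] G y                                ≡⟨ sum-remove {i = x} G ⟩
  G x + ∑[ z < n ] G (punchIn x z)                  ≡⟨ cong₂ _+_ Gx≡0 (sum-cong-≗ G∘punchIn) ⟩
  ∑[ z < n ] count k n (λ w → Q (punchIn x z ∷ vmap (punchIn x) w))  ≡⟨ count-∷ k n _ ⟨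
  count (suc k) n (λ w → Q (vmap (punchIn x) w))    ∎
  where
  open ≡-Reasoning
  G : Fin (suc n) → ℕ
  G y = count k (suc n) (λ v → (not ⌊ x ≟ y ⌋ ∧ notIn x v) ∧ Q (y ∷ v))
  Gx≡0 : G x ≡ 0
  Gx≡0 = count-none k (suc n) λ v → cong (λ s → (not s ∧ notIn x v) ∧ Q (x ∷ v)) (⌊⌋-true (x ≟ x) refl)
  G∘punchIn : ∀ z → G (punchIn x z) ≡ count k n (λ w → Q (punchIn x z ∷ vmap (punchIn x) w))
  G∘punchIn z = trans (count-cong k (suc n) λ v → cong (λ s → (not s ∧ notIn x v) ∧ Q (punchIn x z ∷ v))
                                              (⌊⌋-false (x ≟ punchIn x z) (punchInᵢ≢i x z ∘ sym)))
                      (count-avoiding k x (λ v → Q (punchIn x z ∷ v)))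

punchIn-<ᵇ : ∀ {n} (x : Fin (suc n)) (a c : Fin n) → (toℕ (punchIn x a) <ᵇ toℕ (punchIn x c)) ≡ (toℕ a <ᵇ toℕ c)
punchIn-<ᵇ fzero    a        c        = refl
punchIn-<ᵇ (fsuc x) fzero    fzero    = refl
punchIn-<ᵇ (fsuc x) fzero    (fsuc c) = refl
punchIn-<ᵇ (fsuc x) (fsuc a) fzero    = refl
punchIn-<ᵇ (fsuc x) (fsuc a) (fsuc c) = punchIn-<ᵇ x a c

punchIn-<ᵇ-pivot : ∀ {n} (x : Fin (suc n)) (a : Fin n) → (toℕ (punchIn x a) <ᵇ toℕ x) ≡ (toℕ a <ᵇ toℕ x)
punchIn-<ᵇ-pivot fzero    a        = refl
punchIn-<ᵇ-pivot (fsuc x) fzero    = refl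
punchIn-<ᵇ-pivot (fsuc x) (fsuc a) = punchIn-<ᵇ-pivot x a

-- The number of descents of the word b w, where the value b ∈ ℕ precedes the letters of w.
desAfter : ∀ {n k} → ℕ → Vec (Fin n) k → ℕ
desAfter b []       = 0
desAfter b (y ∷ ys) = (if toℕ y <ᵇ b then 1 else 0) + desAfter (toℕ y) ys

des-∷ : ∀ {n k} (x : Fin n) (v : Vec (Fin n) k) → des (x ∷ v) ≡ desAfter (toℕ x) v
des-∷ x []       = refl
des-∷ x (y ∷ ys) = cong ((if toℕ y <ᵇ toℕ x then 1 else 0) +_) (des-∷ y ys)

desAfter-punchIn : ∀ {n k} (x : Fin (suc n)) b b' (w : Vec (Fin n) k) →
                   (∀ z → (toℕ (punchIn x z) <ᵇ b') ≡ (toℕ z <ᵇ b)) →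
                   desAfter b' (vmap (punchIn x) w) ≡ desAfter b w
desAfter-punchIn x b b' []      _  = refl
desAfter-punchIn x b b' (z ∷ w) <ᵇ≡ =
  cong₂ _+_ (cong (λ t → if t then 1 else 0) (<ᵇ≡ z))
            (desAfter-punchIn x (toℕ z) (toℕ (punchIn x z)) w λ z' → punchIn-<ᵇ x z' z)

-- Deleting the letter x from a word avoiding it and standardising the rest.
count-delete : ∀ k {n} (x : Fin (suc n)) (R : ℕ → Bool) →
  count k (suc n) (λ v → (notIn x v ∧ distinct v) ∧ R (desAfter (toℕ x) v)) ≡
  count k n (λ w → distinct w ∧ R (desAfter (toℕ x) w))
count-delete k {n} x R = begin
  count k (suc n) (λ v → (notIn x v ∧ distinct v) ∧ R (desAfter (toℕ x) v))  ≡⟨ count-cong k (suc n) (λ v → ∧-assoc (notIn x v) _ _) ⟩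
  count k (suc n) (λ v → notIn x v ∧ (distinct v ∧ R (desAfter (toℕ x) v)))  ≡⟨ count-avoiding k x _ ⟩
  count k n (λ w → distinct (vmap (punchIn x) w) ∧ R (desAfter (toℕ x) (vmap (punchIn x) w)))
    ≡⟨ count-cong k n (λ w → cong₂ (λ s t → s ∧ R t) (distinct-punchIn x w) (desAfter-punchIn x (toℕ x) (toℕ x) w (punchIn-<ᵇ-pivot x))) ⟩
  count k n (λ w → distinct w ∧ R (desAfter (toℕ x) w))  ∎
  where open ≡-Reasoning

∑-toℕ : ∀ n (f : ℕ → ℕ) → ∑[ x < n ] f (toℕ x) ≡ sumBelow n f
∑-toℕ zero    f = refl
∑-toℕ (suc n) f = cong (f 0 +_) (∑-toℕ n (f ∘ suc))

E-count : ∀ n b i → count n n (λ w → distinct w ∧ (desAfter b w ≡ᵇ i)) ≡ E n b i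
E-count zero    b zero    = refl
E-count zero    b (suc i) = refl
E-count (suc n) b i = begin
  count (suc n) (suc n) (λ w → distinct w ∧ (desAfter b w ≡ᵇ i))  ≡⟨ count-∷ n (suc n) _ ⟩
  ∑[ z < suc n ] count n (suc n) (λ v → (notIn z v ∧ distinct v) ∧ (desAfter b (z ∷ v) ≡ᵇ i))
    ≡⟨ sum-cong-≗ (λ z → count-delete n z (λ d → ((if toℕ z <ᵇ b then 1 else 0) + d) ≡ᵇ i)) ⟩
  ∑[ z < suc n ] count n n (λ w → distinct w ∧ (((if toℕ z <ᵇ b then 1 else 0) + desAfter (toℕ z) w) ≡ᵇ i))
    ≡⟨ sum-cong-≗ (λ z → second-letter z i) ⟩
  ∑[ z < suc n ] summand (toℕ z)  ≡⟨ ∑-toℕ (suc n) summand ⟩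
  E (suc n) b i  ∎
  where
  open ≡-Reasoning
  summand = λ t → if t <ᵇ b then E⁻ n t i else E n t i
  second-letter : ∀ (z : Fin (suc n)) j →
    count n n (λ w → distinct w ∧ (((if toℕ z <ᵇ b then 1 else 0) + desAfter (toℕ z) w) ≡ᵇ j)) ≡
    (if toℕ z <ᵇ b then E⁻ n (toℕ z) j else E n (toℕ z) j)
  second-letter z j with toℕ z <ᵇ b | j
  ... | true  | zero  = count-none n n (λ w → ∧-zeroʳ (distinct w))
  ... | true  | suc k = E-count n (toℕ z) k
  ... | false | j'    = E-count n (toℕ z) j'

A-as-E : ∀ n i b → b ≤ n → A (n + 1) i (suc b) ≡ E n b i
A-as-E n i b b≤n = begin
  A (n + 1) i (suc b)                                               ≡⟨ cong (λ m → A m i (suc b)) (+-comm n 1) ⟩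
  A (suc n) i (suc b)                                               ≡⟨ length-filterᵇ-filterᵇ _ distinct (allVecs (suc n) (suc n)) ⟩
  count (suc n) (suc n) (λ σ → distinct σ ∧ P σ)                    ≡⟨ count-∷ n (suc n) _ ⟩
  ∑[ x < suc n ] G x                                                ≡⟨ sum-remove {i = x₀} G ⟩
  G x₀ + ∑[ z < n ] G (punchIn x₀ z)                                ≡⟨ cong₂ _+_ Gx₀ (trans (sum-cong-≗ G∘punchIn≡0) (sum-replicate-zero n)) ⟩
  count n n (λ w → distinct w ∧ (desAfter b w ≡ᵇ i)) + 0            ≡⟨ +-identityʳ _ ⟩
  count n n (λ w → distinct w ∧ (desAfter b w ≡ᵇ i))                ≡⟨ E-count n b i ⟩
  E n b i                                                           ∎
  where
  open ≡-Reasoning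
  P : Vec (Fin (suc n)) (suc n) → Bool
  P σ = (des σ ≡ᵇ i) ∧ (first σ ≡ᵇ suc b)
  x₀ : Fin (suc n)
  x₀ = fromℕ< (s≤s b≤n)
  G : Fin (suc n) → ℕ
  G x = count n (suc n) (λ v → (notIn x v ∧ distinct v) ∧ P (x ∷ v))
  -- m ≡ᵇ n is by definition does (m ≟ℕ n).
  Gx₀ : G x₀ ≡ count n n (λ w → distinct w ∧ (desAfter b w ≡ᵇ i))
  Gx₀ = begin
    G x₀  ≡⟨ count-cong n (suc n) (λ v → cong₂ (λ d e → (notIn x₀ v ∧ distinct v) ∧ ((d ≡ᵇ i) ∧ e)) (des-∷ x₀ v) (dec-true (toℕ x₀ ≟ℕ b) (toℕ-fromℕ< _))) ⟩
    count n (suc n) (λ v → (notIn x₀ v ∧ distinct v) ∧ ((desAfter (toℕ x₀) v ≡ᵇ i) ∧ true))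
          ≡⟨ count-cong n (suc n) (λ v → cong ((notIn x₀ v ∧ distinct v) ∧_) (∧-identityʳ _)) ⟩
    count n (suc n) (λ v → (notIn x₀ v ∧ distinct v) ∧ (desAfter (toℕ x₀) v ≡ᵇ i))  ≡⟨ count-delete n x₀ (_≡ᵇ i) ⟩
    count n n (λ w → distinct w ∧ (desAfter (toℕ x₀) w ≡ᵇ i))  ≡⟨ cong (λ t → count n n (λ w → distinct w ∧ (desAfter t w ≡ᵇ i))) (toℕ-fromℕ< _) ⟩
    count n n (λ w → distinct w ∧ (desAfter b w ≡ᵇ i))  ∎
  G∘punchIn≡0 : ∀ z → G (punchIn x₀ z) ≡ 0
  G∘punchIn≡0 z = count-none n (suc n) λ v →
    trans (cong (λ e → (notIn y v ∧ distinct v) ∧ ((des (y ∷ v) ≡ᵇ i) ∧ e))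
                (dec-false (toℕ y ≟ℕ b) λ y≡b → punchInᵢ≢i x₀ z (toℕ-injective (trans y≡b (sym (toℕ-fromℕ< _))))))
          (trans (cong ((notIn y v ∧ distinct v) ∧_) (∧-zeroʳ _)) (∧-zeroʳ _))
    where y = punchIn x₀ z

-- Monotonicity of A(d + 1, j, ·)

A-step : ∀ n i b → b ≤ n → A (suc n + 1) i (suc (suc b)) + E n b i ≡ A (suc n + 1) i (suc b) + E⁻ n b i
A-step n i b b≤n = begin
  A (suc n + 1) i (suc (suc b)) + E n b i  ≡⟨ cong (_+ E n b i) (A-as-E (suc n) i (suc b) (s≤s b≤n)) ⟩
  E (suc n) (suc b) i + E n b i            ≡⟨ E-step b (n ∸ b) i (m+[n∸m]≡n b≤n) ⟩
  E (suc n) b i + E⁻ n b i                 ≡⟨ cong (_+ E⁻ n b i) (A-as-E (suc n) i b (m≤n⇒m≤1+n b≤n)) ⟨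
  A (suc n + 1) i (suc b) + E⁻ n b i       ∎
  where open ≡-Reasoning

A-ascent : ∀ {n i b} → b ≤ n → E n b i ≤ E⁻ n b i → A (suc n + 1) i (suc b) ≤ A (suc n + 1) i (suc (suc b))
A-ascent {n} {i} {b} b≤n E≤E⁻ =
  +-cancelʳ-≤ (E n b i) _ _ (≤-trans (+-monoʳ-≤ _ E≤E⁻) (≤-reflexive (sym (A-step n i b b≤n))))

A-descent : ∀ {n i b} → b ≤ n → E⁻ n b i ≤ E n b i → A (suc n + 1) i (suc (suc b)) ≤ A (suc n + 1) i (suc b)
A-descent {n} {i} {b} b≤n E⁻≤E =
  +-cancelʳ-≤ (E⁻ n b i) _ _ (≤-trans (+-monoʳ-≤ _ E⁻≤E) (≤-reflexive (A-step n i b b≤n)))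

A-increasing-upper : ∀ {d j} → d < 2 * j → ∀ {k} → 1 ≤ k → k ≤ d → A (d + 1) j k ≤ A (d + 1) j (suc k)
A-increasing-upper {suc n} d<2j {suc b} _ (s≤s b≤n) = A-ascent b≤n (E-descending d<2j b≤n)

A-decreasing-lower : ∀ {d j} → 2 * j < d → ∀ {k} → 1 ≤ k → k ≤ d → A (d + 1) j (suc k) ≤ A (d + 1) j k
A-decreasing-lower {suc n} (s≤s 2j≤n) {suc b} _ (s≤s b≤n) = A-descent b≤n (E-ascending 2j≤n b≤n)

A-increasing-middle : ∀ {d m} → d ≡ 2 * m → ∀ {k} → 1 ≤ k → k ≤ m → A (d + 1) m k ≤ A (d + 1) m (suc k)
A-increasing-middle {suc n} {m} d≡2m {suc b} _ b<m =
  A-ascent (≤-pred (≤-trans b<m (subst (m ≤_) (sym d≡2m) (m≤n*m m 2)))) (E-descending-middle (sym d≡2m) b<m)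
A-increasing-middle {zero} {zero}  _  {suc _} _ ()
A-increasing-middle {zero} {suc _} ()

A-decreasing-middle : ∀ {d m} → d ≡ 2 * m → ∀ {k} → m < k → k ≤ d → A (d + 1) m (suc k) ≤ A (d + 1) m k
A-decreasing-middle {suc n} d≡2m {suc b} (s≤s m≤b) (s≤s b≤n) = A-descent b≤n (E-ascending-middle (sym d≡2m) m≤b b≤n)

A-first-last : ∀ {d j} → 1 ≤ d → A (d + 1) j 1 ≡ A (d + 1) (suc j) (d + 1)
A-first-last {suc n} {j} _ = begin
  A (suc n + 1) j 1                  ≡⟨ A-as-E (suc n) j 0 z≤n ⟩
  E (suc n) 0 j                      ≡⟨ E-first-last n j ⟩
  E (suc n) (suc n) (suc j)          ≡⟨ A-as-E (suc n) (suc j) (suc n) ≤-refl ⟨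
  A (suc n + 1) (suc j) (suc (suc n))  ≡⟨ cong (A (suc n + 1) (suc j)) (+-comm 1 (suc n)) ⟩
  A (suc n + 1) (suc j) (suc n + 1)  ∎
  where open ≡-Reasoning

[d+2]/2≤j⇒d<2j : ∀ {d j} → (d + 2) / 2 ≤ j → d < 2 * j
[d+2]/2≤j⇒d<2j {d} {j} h = ≤-pred (begin
  suc (suc d)                      ≡⟨ +-comm 2 d ⟩
  d + 2                            ≡⟨ m≡m%n+[m/n]*n (d + 2) 2 ⟩
  (d + 2) % 2 + (d + 2) / 2 * 2    ≤⟨ +-mono-≤ (≤-pred (m%n<n (d + 2) 2)) (*-monoˡ-≤ 2 h) ⟩
  1 + j * 2                        ≡⟨ cong suc (*-comm j 2) ⟩
  suc (2 * j)                      ∎)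
  where open ≤-Reasoning

m<n+1⇒m≤n : ∀ {m n} → m < n + 1 → m ≤ n
m<n+1⇒m≤n {m} {n} m<n+1 = m<1+n⇒m≤n (subst (m <_) (+-comm n 1) m<n+1)

corollary4p9 : (d : ℕ) →
    ((j : ℕ) → (d + 2) / 2 ≤ j → j ≤ d →
    (k : ℕ) → 1 ≤ k → k < d + 1 → A (d + 1) j k ≤ A (d + 1) j (suc k))
    × ((j : ℕ) → 2 * j + 1 ≤ d →
    (k : ℕ) → 1 ≤ k → k < d + 1 → A (d + 1) j k ≥ A (d + 1) j (suc k))
    × ((m : ℕ) → d ≡ 2 * m →
    ((k : ℕ) → 1 ≤ k → k < m + 1 → A (d + 1) m k ≤ A (d + 1) m (suc k))
    × ((k : ℕ) → m + 1 ≤ k → k < d + 1 → A (d + 1) m k ≥ A (d + 1) m (suc k)))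
    × ((j : ℕ) → j + 1 ≤ d → A (d + 1) j 1 ≡ A (d + 1) (suc j) (d + 1))
corollary4p9 d =
    (λ j [d+2]/2≤j _ k 1≤k k<d+1 →
       A-increasing-upper ([d+2]/2≤j⇒d<2j [d+2]/2≤j) 1≤k (m<n+1⇒m≤n k<d+1))
  , (λ j 2j+1≤d k 1≤k k<d+1 →
       A-decreasing-lower (subst (_≤ d) (+-comm (2 * j) 1) 2j+1≤d) 1≤k (m<n+1⇒m≤n k<d+1))
  , (λ m d≡2m →
         (λ k 1≤k k<m+1 → A-increasing-middle d≡2m 1≤k (m<n+1⇒m≤n k<m+1))
       , (λ k m+1≤k k<d+1 → A-decreasing-middle d≡2m (subst (_≤ k) (+-comm m 1) m+1≤k) (m<n+1⇒m≤n k<d+1)))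
  , (λ j j+1≤d → A-first-last (≤-trans (m≤n+m 1 j) j+1≤d))
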